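{- For every integer $n\geq 0$, \[ \sum_{k=0}^{n}(-1)^{n-k}\binom{n}{k}P_k(x^2)(1-x)^{2(n-k)}=x^n\binom{2n}{n}. \]
   Context: For $k\geq 0$, $P_k(x)=\sum_{j=0}^{k}\binom{k}{j}^2x^j$ denotes the type $B$ Narayana polynomial (so $P_0(x)=1$). -}

module Defs where

open import Level using (Level)
open import Algebra.Bundles using (CommutativeRing)
open import Data.Nat using (ℕ; zero; suc; _∸_) renaming (_*_ to _*ℕ_)
open import Data.Nat.Combinatorics using (_C_)

module _ {c ℓ : Level} (R : CommutativeRing c ℓ) where
  open CommutativeRing R

  fromℕ : ℕ → Carrier
  fromℕ zero    = 0#
  fromℕ (suc n) = 1# + fromℕ n

  pow : Carrier → ℕ → Carrier
  pow x zero    = 1#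
  pow x (suc n) = x * pow x n

  sumTo : ℕ → (ℕ → Carrier) → Carrier
  sumTo zero    f = f 0
  sumTo (suc n) f = sumTo n f + f (suc n)

  signPow : ℕ → Carrier
  signPow n = pow (- 1#) n

  narayanaB : ℕ → Carrier → Carrier
  narayanaB k y = sumTo k (λ j → fromℕ ((k C j) *ℕ (k C j)) * pow y j)

module Submission where

-- Put y = x², s = -(1-x)² and, for d ≥ 0, let
--   L(k,d) = x^d Σ_j C(k,j) C(k,d+j) y^j ,
-- the coefficient of t^d in the Laurent polynomial ((1 + x t)(1 + x/t))^k; L(k,0) = P_k(x²).
-- The theorem says that B(n,0) = x^n C(2n,n), where
--   B(n,d) = Σ_k C(n,k) s^(n-k) L(k,d)
-- is the binomial transform (with multiplier s) of k ↦ L(k,d).  Since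
-- (1 + x t)(1 + x/t) + s = x (1+t)²/t, we expect B(n,d) = x^n C(2n, d+n) for every d,
-- and this stronger statement is proved by induction on n.

open import Defs
open import Level using (Level)
open import Algebra.Bundles using (CommutativeRing)
open import Data.Nat using (ℕ; _∸_) renaming (_*_ to _*ℕ_)
open import Data.Nat.Combinatorics using (_C_)

open import Data.Nat using (zero; suc; _≤_) renaming (_+_ to _+ℕ_)
import Data.Nat.Properties as ℕ
open import Data.Nat.Combinatorics using (nCk+nC[k+1]≡[n+1]C[k+1]; nCk≡nC[n∸k]; k>n⇒nCk≡0)
open import Data.Nat.Solver using (module +-*-Solver)
open import Relation.Binary.PropositionalEquality as ≡ using (_≡_)

pascal : ∀ n k → suc n C suc k ≡ n C k +ℕ n C suc k
pascal n k = ≡.sym (nCk+nC[k+1]≡[n+1]C[k+1] n k)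

C-beyond : ∀ n → n C suc n ≡ 0
C-beyond n = k>n⇒nCk≡0 (ℕ.n<1+n n)

shift : (ℕ → ℕ) → ℕ → ℕ
shift g zero    = 0
shift g (suc j) = g j

pascal-row : ∀ n k → suc n C k ≡ n C k +ℕ shift (n C_) k
pascal-row n zero    = ≡.refl
pascal-row n (suc k) = ≡.trans (pascal n k) (ℕ.+-comm (n C k) (n C suc k))

cross : ℕ → ℕ → ℕ → ℕ
cross k d j = (k C j) *ℕ (k C (d +ℕ j))

cross-beyond : ∀ k d → cross k d (suc k) ≡ 0
cross-beyond k d = ≡.cong (_*ℕ (k C (d +ℕ suc k))) (C-beyond k)

-- Product Pascal rules: expanding both factors of C(k+1,j) C(k+1,d+j) by Pascal's rule
-- writes cross (k+1) d as a sequence vanishing at k+1 plus a shifted sequence.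
-- For d = 0 the two mixed products C(k,j) C(k,j-1) are both shifted copies of cross k 1.
cross-pascal-zero : ∀ k j →
  cross (suc k) 0 j ≡ cross k 0 j +ℕ shift (λ i → cross k 0 i +ℕ (cross k 1 i +ℕ cross k 1 i)) j
cross-pascal-zero k zero    = ≡.refl
cross-pascal-zero k (suc i) =
  ≡.trans (≡.cong (λ c → c *ℕ c) (pascal k i))
          (solve 2 (λ a a′ → (a :+ a′) :* (a :+ a′) := a′ :* a′ :+ (a :* a :+ (a :* a′ :+ a :* a′)))
                 ≡.refl (k C i) (k C suc i))
  where open +-*-Solver

cross-pascal-suc : ∀ k e j →
  cross (suc k) (suc e) j
    ≡ (cross k (suc e) j +ℕ cross k e j)
      +ℕ shift (λ i → cross k (suc e) i +ℕ cross k (suc (suc e)) i) j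
cross-pascal-suc k e zero =
  ≡.trans (≡.cong (1 *ℕ_) (pascal k (e +ℕ 0)))
          (solve 2 (λ b b′ → con 1 :* (b :+ b′) := (con 1 :* b′ :+ con 1 :* b) :+ con 0)
                 ≡.refl (k C (e +ℕ 0)) (k C suc (e +ℕ 0)))
  where open +-*-Solver
cross-pascal-suc k e (suc i) = begin
    (suc k C suc i) *ℕ (suc k C suc (e +ℕ suc i))
  ≡⟨ ≡.cong (λ m′ → (suc k C suc i) *ℕ (suc k C suc m′)) (ℕ.+-suc e i) ⟩
    (suc k C suc i) *ℕ (suc k C suc (suc m))
  ≡⟨ ≡.cong₂ _*ℕ_ (pascal k i) (pascal k (suc m)) ⟩
    (a +ℕ a′) *ℕ (b +ℕ b′)
  ≡⟨ solve 4 (λ a a′ b b′ → (a :+ a′) :* (b :+ b′) := (a′ :* b′ :+ a′ :* b) :+ (a :* b :+ a :* b′))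
           ≡.refl a a′ b b′ ⟩
    (a′ *ℕ b′ +ℕ a′ *ℕ b) +ℕ (a *ℕ b +ℕ a *ℕ b′)
  ≡⟨ ≡.cong (λ m′ → (a′ *ℕ (k C suc m′) +ℕ a′ *ℕ (k C m′)) +ℕ (a *ℕ b +ℕ a *ℕ b′)) (≡.sym (ℕ.+-suc e i)) ⟩
    cross k (suc e) (suc i) +ℕ cross k e (suc i) +ℕ (cross k (suc e) i +ℕ cross k (suc (suc e)) i) ∎
  where
  open ≡.≡-Reasoning
  open +-*-Solver
  m = e +ℕ i
  a = k C i
  a′ = k C suc i
  b = k C suc m
  b′ = k C suc (suc m)

central-pascal-suc : ∀ n e →
  2 *ℕ suc n C (suc e +ℕ suc n)
    ≡ (2 *ℕ n C (e +ℕ n)) +ℕ ((2 *ℕ n C suc (e +ℕ n)) +ℕ (2 *ℕ n C suc (e +ℕ n)))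
      +ℕ (2 *ℕ n C suc (suc (e +ℕ n)))
central-pascal-suc n e = begin
    2 *ℕ suc n C suc (e +ℕ suc n)
  ≡⟨ ≡.cong₂ (λ r m′ → r C suc m′) (ℕ.*-suc 2 n) (ℕ.+-suc e n) ⟩
    suc (suc r) C suc (suc m)
  ≡⟨ pascal (suc r) (suc m) ⟩
    (suc r C suc m) +ℕ (suc r C suc (suc m))
  ≡⟨ ≡.cong₂ _+ℕ_ (pascal r m) (pascal r (suc m)) ⟩
    ((r C m) +ℕ (r C suc m)) +ℕ ((r C suc m) +ℕ (r C suc (suc m)))
  ≡⟨ solve 3 (λ a b c → (a :+ b) :+ (b :+ c) := a :+ (b :+ b) :+ c) ≡.refl (r C m) (r C suc m) (r C suc (suc m)) ⟩
    (r C m) +ℕ ((r C suc m) +ℕ (r C suc m)) +ℕ (r C suc (suc m)) ∎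
  where
  open ≡.≡-Reasoning
  open +-*-Solver
  r = 2 *ℕ n
  m = e +ℕ n

-- For d = 0 the rule uses the symmetry C(2n+1, n) = C(2n+1, n+1) of the middle of a row:
-- C(2n+2, n+1) = 2 (C(2n, n) + C(2n, n+1)).
central-pascal-zero : ∀ n →
  2 *ℕ suc n C suc n ≡ ((2 *ℕ n C n) +ℕ (2 *ℕ n C suc n)) +ℕ ((2 *ℕ n C n) +ℕ (2 *ℕ n C suc n))
central-pascal-zero n = begin
    2 *ℕ suc n C suc n
  ≡⟨ ≡.cong (_C suc n) (ℕ.*-suc 2 n) ⟩
    suc (suc r) C suc n
  ≡⟨ pascal (suc r) n ⟩
    (suc r C n) +ℕ (suc r C suc n)
  ≡⟨ ≡.cong (_+ℕ (suc r C suc n)) middle-symmetry ⟩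
    (suc r C suc n) +ℕ (suc r C suc n)
  ≡⟨ ≡.cong₂ _+ℕ_ (pascal r n) (pascal r n) ⟩
    ((r C n) +ℕ (r C suc n)) +ℕ ((r C n) +ℕ (r C suc n)) ∎
  where
  open ≡.≡-Reasoning
  r = 2 *ℕ n
  middle-symmetry : suc r C n ≡ suc r C suc n
  middle-symmetry = begin
      suc r C n
    ≡⟨ nCk≡nC[n∸k] (ℕ.m≤n⇒m≤1+n (ℕ.m≤m+n n (n +ℕ 0))) ⟩
      suc r C (suc r ∸ n)
    ≡⟨ ≡.cong (λ n′ → suc r C (suc (n +ℕ n′) ∸ n)) (ℕ.+-identityʳ n) ⟩
      suc r C (suc n +ℕ n ∸ n)
    ≡⟨ ≡.cong (suc r C_) (ℕ.m+n∸n≡m (suc n) n) ⟩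
      suc r C suc n ∎

module RingIdentities {r ℓ : Level} (R : CommutativeRing r ℓ) where

  open CommutativeRing R
  open import Relation.Binary.Reasoning.Setoid setoid
  open import Algebra.Solver.Ring.NaturalCoefficients.Default commutativeSemiring
    using (solve; _:=_; _:+_; _:*_)
  open import Algebra.Properties.Ring ring using (-1*x≈-x; -‿distribˡ-*; -‿distribʳ-*; -‿involutive)

  ι : ℕ → Carrier
  ι = fromℕ R

  infixr 8 _^_
  _^_ : Carrier → ℕ → Carrier
  a ^ m = pow R a m

  Σ : ℕ → (ℕ → Carrier) → Carrier
  Σ = sumTo R

  ι-+ : ∀ a b → ι (a +ℕ b) ≈ ι a + ι b
  ι-+ zero    b = sym (+-identityˡ (ι b))
  ι-+ (suc a) b = trans (+-congˡ (ι-+ a b)) (sym (+-assoc 1# (ι a) (ι b)))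

  Σ-cong≤ : ∀ n {f g : ℕ → Carrier} → (∀ j → j ≤ n → f j ≈ g j) → Σ n f ≈ Σ n g
  Σ-cong≤ zero    f≈g = f≈g 0 ℕ.≤-refl
  Σ-cong≤ (suc n) f≈g =
    +-cong (Σ-cong≤ n (λ j j≤n → f≈g j (ℕ.m≤n⇒m≤1+n j≤n))) (f≈g (suc n) ℕ.≤-refl)

  Σ-cong : ∀ n {f g : ℕ → Carrier} → (∀ j → f j ≈ g j) → Σ n f ≈ Σ n g
  Σ-cong n f≈g = Σ-cong≤ n (λ j _ → f≈g j)

  Σ-+ : ∀ n (f g : ℕ → Carrier) → Σ n (λ j → f j + g j) ≈ Σ n f + Σ n g
  Σ-+ zero    f g = refl
  Σ-+ (suc n) f g = trans (+-congʳ (Σ-+ n f g))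
    (solve 4 (λ a b c d → (a :+ b) :+ (c :+ d) := (a :+ c) :+ (b :+ d)) refl _ _ _ _)

  Σ-*ˡ : ∀ n a (f : ℕ → Carrier) → Σ n (λ j → a * f j) ≈ a * Σ n f
  Σ-*ˡ zero    a f = refl
  Σ-*ˡ (suc n) a f = trans (+-congʳ (Σ-*ˡ n a f)) (sym (distribˡ a _ _))

  Σ-head : ∀ n (f : ℕ → Carrier) → Σ (suc n) f ≈ f 0 + Σ n (λ j → f (suc j))
  Σ-head zero    f = refl
  Σ-head (suc n) f = trans (+-congʳ (Σ-head n f)) (+-assoc _ _ _)

  Σ-pascal : ∀ n (u v : ℕ → ℕ) (h : ℕ → Carrier) → u (suc n) ≡ 0 →
    Σ (suc n) (λ j → ι (u j +ℕ shift v j) * h j)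
      ≈ Σ n (λ j → ι (u j) * h j) + Σ n (λ j → ι (v j) * h (suc j))
  Σ-pascal n u v h u-end = begin
      Σ (suc n) (λ j → ι (u j +ℕ shift v j) * h j)
    ≈⟨ Σ-cong (suc n) (λ j → trans (*-congʳ (ι-+ (u j) (shift v j))) (distribʳ (h j) _ _)) ⟩
      Σ (suc n) (λ j → ι (u j) * h j + ι (shift v j) * h j)
    ≈⟨ Σ-+ (suc n) _ _ ⟩
      (Σ n (λ j → ι (u j) * h j) + ι (u (suc n)) * h (suc n)) + Σ (suc n) (λ j → ι (shift v j) * h j)
    ≈⟨ +-cong (+-congˡ last-vanishes) (Σ-head n _) ⟩
      (Σ n (λ j → ι (u j) * h j) + 0#) + (0# * h 0 + Σ n (λ j → ι (v j) * h (suc j)))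
    ≈⟨ +-cong (+-identityʳ _) (trans (+-congʳ (zeroˡ (h 0))) (+-identityˡ _)) ⟩
      Σ n (λ j → ι (u j) * h j) + Σ n (λ j → ι (v j) * h (suc j)) ∎
    where
    last-vanishes : ι (u (suc n)) * h (suc n) ≈ 0#
    last-vanishes = trans (*-congʳ (reflexive (≡.cong ι u-end))) (zeroˡ (h (suc n)))

  pow-neg-square : ∀ a m → (- (a * a)) ^ m ≈ signPow R m * a ^ (2 *ℕ m)
  pow-neg-square a zero    = sym (*-identityˡ 1#)
  pow-neg-square a (suc m) = begin
      - (a * a) * (- (a * a)) ^ m
    ≈⟨ *-cong (sym (-1*x≈-x (a * a))) (pow-neg-square a m) ⟩
      (- 1# * (a * a)) * (signPow R m * a ^ (2 *ℕ m))
    ≈⟨ solve 4 (λ o a σ p → (o :* (a :* a)) :* (σ :* p) := (o :* σ) :* (a :* (a :* p))) refl _ a _ _ ⟩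
      (- 1# * signPow R m) * (a * (a * a ^ (2 *ℕ m)))
    ≡⟨ ≡.cong (λ i → (- 1# * signPow R m) * a ^ i) (ℕ.*-suc 2 m) ⟨
      signPow R (suc m) * a ^ (2 *ℕ suc m) ∎

  transform : Carrier → (ℕ → Carrier) → ℕ → Carrier
  transform s f n = Σ n (λ k → ι (n C k) * (s ^ (n ∸ k) * f k))

  transform-zero : ∀ s (f : ℕ → Carrier) → transform s f 0 ≈ f 0
  transform-zero s f = trans (*-cong (+-identityʳ 1#) (*-identityˡ (f 0))) (*-identityˡ (f 0))

  transform-cong : ∀ s n {f g : ℕ → Carrier} → (∀ k → f k ≈ g k) → transform s f n ≈ transform s g n
  transform-cong s n f≈g = Σ-cong n (λ k → *-congˡ (*-congˡ (f≈g k)))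

  transform-+ : ∀ s n (f g : ℕ → Carrier) →
    transform s (λ k → f k + g k) n ≈ transform s f n + transform s g n
  transform-+ s n f g = trans
    (Σ-cong n (λ k → solve 4 (λ c p a b → c :* (p :* (a :+ b)) := c :* (p :* a) :+ c :* (p :* b))
                             refl _ _ (f k) (g k)))
    (Σ-+ n _ _)

  transform-*ˡ : ∀ s n a (f : ℕ → Carrier) → transform s (λ k → a * f k) n ≈ a * transform s f n
  transform-*ˡ s n a f = trans
    (Σ-cong n (λ k → solve 4 (λ c p a b → c :* (p :* (a :* b)) := a :* (c :* (p :* b))) refl _ _ a (f k)))
    (Σ-*ˡ n a _)

  transform-linear : ∀ s n a b (f g : ℕ → Carrier) →
    transform s (λ k → a * f k + b * g k) n ≈ a * transform s f n + b * transform s g n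
  transform-linear s n a b f g =
    trans (transform-+ s n _ _) (+-cong (transform-*ˡ s n a f) (transform-*ˡ s n b g))

  transform-suc : ∀ s (f : ℕ → Carrier) n →
    transform s f (suc n) ≈ s * transform s f n + transform s (λ k → f (suc k)) n
  transform-suc s f n = begin
      transform s f (suc n)
    ≈⟨ Σ-cong (suc n) (λ k → *-congʳ (reflexive (≡.cong ι (pascal-row n k)))) ⟩
      Σ (suc n) (λ k → ι ((n C k) +ℕ shift (n C_) k) * h k)
    ≈⟨ Σ-pascal n (n C_) (n C_) h (C-beyond n) ⟩
      Σ n (λ k → ι (n C k) * h k) + transform s (λ k → f (suc k)) n
    ≈⟨ +-congʳ (trans (Σ-cong≤ n one-more-factor) (Σ-*ˡ n s _)) ⟩
      s * transform s f n + transform s (λ k → f (suc k)) n ∎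
    where
    h : ℕ → Carrier
    h k = s ^ (suc n ∸ k) * f k
    one-more-factor : ∀ k → k ≤ n → ι (n C k) * h k ≈ s * (ι (n C k) * (s ^ (n ∸ k) * f k))
    one-more-factor k k≤n = begin
        ι (n C k) * (s ^ (suc n ∸ k) * f k)
      ≡⟨ ≡.cong (λ i → ι (n C k) * (s ^ i * f k)) (ℕ.+-∸-assoc 1 k≤n) ⟩
        ι (n C k) * ((s * s ^ (n ∸ k)) * f k)
      ≈⟨ solve 4 (λ c s p a → c :* ((s :* p) :* a) := s :* (c :* (p :* a))) refl _ s _ _ ⟩
        s * (ι (n C k) * (s ^ (n ∸ k) * f k)) ∎

  poly : Carrier → ℕ → (ℕ → ℕ) → Carrier
  poly y n g = Σ n (λ j → ι (g j) * y ^ j)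

  poly-cong : ∀ y n {g g′ : ℕ → ℕ} → (∀ j → g j ≡ g′ j) → poly y n g ≈ poly y n g′
  poly-cong y n g≡g′ = Σ-cong n (λ j → *-congʳ (reflexive (≡.cong ι (g≡g′ j))))

  poly-+ : ∀ y n (g g′ : ℕ → ℕ) → poly y n (λ j → g j +ℕ g′ j) ≈ poly y n g + poly y n g′
  poly-+ y n g g′ = trans (Σ-cong n (λ j → trans (*-congʳ (ι-+ (g j) (g′ j))) (distribʳ _ _ _))) (Σ-+ n _ _)

  poly-pascal : ∀ y n (u v : ℕ → ℕ) → u (suc n) ≡ 0 →
    poly y (suc n) (λ j → u j +ℕ shift v j) ≈ poly y n u + y * poly y n v
  poly-pascal y n u v u-end = trans (Σ-pascal n u v (y ^_) u-end) (+-congˡ (trans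
    (Σ-cong n (λ j → solve 3 (λ a y p → a :* (y :* p) := y :* (a :* p)) refl _ y _))
    (Σ-*ˡ n y _)))

  narayanaGen : Carrier → ℕ → ℕ → Carrier
  narayanaGen y k d = poly y k (cross k d)

  narayanaGen-suc-zero : ∀ y k →
    narayanaGen y (suc k) 0
      ≈ narayanaGen y k 0 + y * (narayanaGen y k 0 + (narayanaGen y k 1 + narayanaGen y k 1))
  narayanaGen-suc-zero y k = begin
      narayanaGen y (suc k) 0
    ≈⟨ poly-cong y (suc k) (cross-pascal-zero k) ⟩
      poly y (suc k) (λ j → cross k 0 j +ℕ shift v j)
    ≈⟨ poly-pascal y k (cross k 0) v (cross-beyond k 0) ⟩
      narayanaGen y k 0 + y * poly y k v
    ≈⟨ +-congˡ (*-congˡ (trans (poly-+ y k (cross k 0) _) (+-congˡ (poly-+ y k (cross k 1) (cross k 1))))) ⟩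
      narayanaGen y k 0 + y * (narayanaGen y k 0 + (narayanaGen y k 1 + narayanaGen y k 1)) ∎
    where
    v : ℕ → ℕ
    v i = cross k 0 i +ℕ (cross k 1 i +ℕ cross k 1 i)

  narayanaGen-suc-suc : ∀ y k e →
    narayanaGen y (suc k) (suc e)
      ≈ (narayanaGen y k (suc e) + narayanaGen y k e)
        + y * (narayanaGen y k (suc e) + narayanaGen y k (suc (suc e)))
  narayanaGen-suc-suc y k e = begin
      narayanaGen y (suc k) (suc e)
    ≈⟨ poly-cong y (suc k) (cross-pascal-suc k e) ⟩
      poly y (suc k) (λ j → u j +ℕ shift v j)
    ≈⟨ poly-pascal y k u v (≡.cong₂ _+ℕ_ (cross-beyond k (suc e)) (cross-beyond k e)) ⟩
      poly y k u + y * poly y k v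
    ≈⟨ +-cong (poly-+ y k (cross k (suc e)) (cross k e))
              (*-congˡ (poly-+ y k (cross k (suc e)) (cross k (suc (suc e))))) ⟩
      (narayanaGen y k (suc e) + narayanaGen y k e)
        + y * (narayanaGen y k (suc e) + narayanaGen y k (suc (suc e))) ∎
    where
    u v : ℕ → ℕ
    u j = cross k (suc e) j +ℕ cross k e j
    v i = cross k (suc e) i +ℕ cross k (suc (suc e)) i

  module AtPoint (x : Carrier) where

    y s : Carrier
    y = x * x
    s = - ((1# - x) * (1# - x))

    -- Since (1 + x t)(1 + x/t) + s = x (1+t)²/t, the multiplier s turns 1 + y into 2x.
    multiplier-shift : ∀ b → s * b + (1# + y) * b ≈ (x + x) * b
    multiplier-shift b = trans (sym (distribʳ b s (1# + y)))
                               (*-congʳ (trans (+-congˡ (sym square-expansion)) cancel))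
      where
      t = - x
      t²≈x² : t * t ≈ x * x
      t²≈x² = trans (sym (-‿distribˡ-* x t)) (trans (-‿cong (sym (-‿distribʳ-* x x))) (-‿involutive (x * x)))
      square-expansion : (1# - x) * (1# - x) + (x + x) ≈ 1# + y
      square-expansion = begin
          (1# + t) * (1# + t) + (x + x)
        ≈⟨ solve 3 (λ o t x → (o :+ t) :* (o :+ t) :+ (x :+ x) := (o :* o :+ t :* t) :+ ((x :+ o :* t) :+ (x :+ o :* t)))
                 refl 1# t x ⟩
          (1# * 1# + t * t) + ((x + 1# * t) + (x + 1# * t))
        ≈⟨ +-cong (+-cong (*-identityˡ 1#) t²≈x²) (+-cong x-t≈0 x-t≈0) ⟩
          (1# + y) + (0# + 0#)
        ≈⟨ trans (+-congˡ (+-identityˡ 0#)) (+-identityʳ (1# + y)) ⟩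
          1# + y ∎
        where
        x-t≈0 : x + 1# * t ≈ 0#
        x-t≈0 = trans (+-congˡ (*-identityˡ t)) (-‿inverseʳ x)
      cancel : - ((1# - x) * (1# - x)) + ((1# - x) * (1# - x) + (x + x)) ≈ x + x
      cancel = trans (sym (+-assoc _ _ _)) (trans (+-congʳ (-‿inverseˡ _)) (+-identityˡ (x + x)))

    -- L(k,d) = x^d N_{k,d}(y), the coefficient of t^d in ((1 + x t)(1 + x/t))^k.
    laurent : ℕ → ℕ → Carrier
    laurent k d = x ^ d * narayanaGen y k d

    -- Multiplying by (1 + x t)(1 + x/t) = (1 + y) + x t + x/t, using L(k,-1) = L(k,1).
    laurent-suc-zero : ∀ k → laurent (suc k) 0 ≈ (1# + y) * laurent k 0 + (x + x) * laurent k 1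
    laurent-suc-zero k = begin
        1# * narayanaGen y (suc k) 0
      ≈⟨ trans (*-identityˡ _) (narayanaGen-suc-zero y k) ⟩
        N₀ + y * (N₀ + (N₁ + N₁))
      ≈⟨ solve 3 (λ x a b → a :+ x :* x :* (a :+ (b :+ b)) := (a :+ x :* x :* a) :+ (x :+ x) :* (x :* b))
               refl x N₀ N₁ ⟩
        (N₀ + y * N₀) + (x + x) * (x * N₁)
      ≈⟨ +-cong (sym (trans (distribʳ _ 1# y) (+-cong (trans (*-identityˡ _) (*-identityˡ N₀)) (*-congˡ (*-identityˡ N₀)))))
                (*-congˡ (*-congʳ (sym (*-identityʳ x)))) ⟩
        (1# + y) * laurent k 0 + (x + x) * laurent k 1 ∎
      where
      N₀ = narayanaGen y k 0
      N₁ = narayanaGen y k 1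

    laurent-suc-suc : ∀ k e →
      laurent (suc k) (suc e)
        ≈ (1# + y) * laurent k (suc e) + (x * laurent k e + x * laurent k (suc (suc e)))
    laurent-suc-suc k e = begin
        x ^ suc e * narayanaGen y (suc k) (suc e)
      ≈⟨ *-congˡ (narayanaGen-suc-suc y k e) ⟩
        (x * p) * ((N₁ + N₀) + y * (N₁ + N₂))
      ≈⟨ solve 5 (λ x p a b c → (x :* p) :* ((b :+ a) :+ x :* x :* (b :+ c))
                   := ((x :* p) :* b :+ x :* x :* ((x :* p) :* b)) :+ (x :* (p :* a) :+ x :* ((x :* (x :* p)) :* c)))
               refl x p N₀ N₁ N₂ ⟩
        (laurent k (suc e) + y * laurent k (suc e)) + (x * laurent k e + x * laurent k (suc (suc e)))
      ≈⟨ +-congʳ (sym (trans (distribʳ _ 1# y) (+-congʳ (*-identityˡ _)))) ⟩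
        (1# + y) * laurent k (suc e) + (x * laurent k e + x * laurent k (suc (suc e))) ∎
      where
      p = x ^ e
      N₀ = narayanaGen y k e
      N₁ = narayanaGen y k (suc e)
      N₂ = narayanaGen y k (suc (suc e))

    -- B(n,d) = Σ_k C(n,k) s^(n-k) L(k,d), the coefficient of t^d in (x (1+t)²/t)^n.
    B : ℕ → ℕ → Carrier
    B n d = transform s (λ k → laurent k d) n

    B-suc-zero : ∀ n → B (suc n) 0 ≈ (x + x) * B n 0 + (x + x) * B n 1
    B-suc-zero n = begin
        B (suc n) 0
      ≈⟨ transform-suc s (λ k → laurent k 0) n ⟩
        s * B n 0 + transform s (λ k → laurent (suc k) 0) n
      ≈⟨ +-congˡ (trans (transform-cong s n laurent-suc-zero) (transform-linear s n (1# + y) (x + x) _ _)) ⟩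
        s * B n 0 + ((1# + y) * B n 0 + (x + x) * B n 1)
      ≈⟨ trans (sym (+-assoc _ _ _)) (+-congʳ (multiplier-shift (B n 0))) ⟩
        (x + x) * B n 0 + (x + x) * B n 1 ∎

    B-suc-suc : ∀ n e → B (suc n) (suc e) ≈ (x + x) * B n (suc e) + (x * B n e + x * B n (suc (suc e)))
    B-suc-suc n e = begin
        B (suc n) (suc e)
      ≈⟨ transform-suc s (λ k → laurent k (suc e)) n ⟩
        s * B n (suc e) + transform s (λ k → laurent (suc k) (suc e)) n
      ≈⟨ +-congˡ (trans (transform-cong s n (λ k → laurent-suc-suc k e))
                        (trans (transform-+ s n _ _)
                               (+-cong (transform-*ˡ s n (1# + y) _) (transform-linear s n x x _ _)))) ⟩
        s * B n (suc e) + ((1# + y) * B n (suc e) + (x * B n e + x * B n (suc (suc e))))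
      ≈⟨ trans (sym (+-assoc _ _ _)) (+-congʳ (multiplier-shift (B n (suc e)))) ⟩
        (x + x) * B n (suc e) + (x * B n e + x * B n (suc (suc e))) ∎

    B-closed : ∀ n d → B n d ≈ x ^ n * ι (2 *ℕ n C (d +ℕ n))
    B-closed zero d@zero    = trans (transform-zero s (λ k → laurent k d)) (*-congˡ (*-identityʳ (ι 1)))
    B-closed zero d@(suc e) = trans (transform-zero s (λ k → laurent k d))
                                    (trans (*-congˡ (zeroˡ 1#)) (trans (zeroʳ _) (sym (zeroʳ 1#))))
    B-closed (suc n) zero = begin
        B (suc n) 0
      ≈⟨ B-suc-zero n ⟩
        (x + x) * B n 0 + (x + x) * B n 1
      ≈⟨ +-cong (*-congˡ (B-closed n 0)) (*-congˡ (B-closed n 1)) ⟩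
        (x + x) * (x ^ n * ι a) + (x + x) * (x ^ n * ι b)
      ≈⟨ solve 4 (λ x p a b → (x :+ x) :* (p :* a) :+ (x :+ x) :* (p :* b) := (x :* p) :* ((a :+ b) :+ (a :+ b)))
               refl x (x ^ n) (ι a) (ι b) ⟩
        x ^ suc n * ((ι a + ι b) + (ι a + ι b))
      ≈⟨ *-congˡ (sym (trans (ι-+ (a +ℕ b) (a +ℕ b)) (+-cong (ι-+ a b) (ι-+ a b)))) ⟩
        x ^ suc n * ι ((a +ℕ b) +ℕ (a +ℕ b))
      ≡⟨ ≡.cong (λ c → x ^ suc n * ι c) (central-pascal-zero n) ⟨
        x ^ suc n * ι (2 *ℕ suc n C suc n) ∎
      where
      a = 2 *ℕ n C n
      b = 2 *ℕ n C suc n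
    B-closed (suc n) (suc e) = begin
        B (suc n) (suc e)
      ≈⟨ B-suc-suc n e ⟩
        (x + x) * B n (suc e) + (x * B n e + x * B n (suc (suc e)))
      ≈⟨ +-cong (*-congˡ (B-closed n (suc e))) (+-cong (*-congˡ (B-closed n e)) (*-congˡ (B-closed n (suc (suc e))))) ⟩
        (x + x) * (x ^ n * ι b) + (x * (x ^ n * ι a) + x * (x ^ n * ι c))
      ≈⟨ solve 5 (λ x p a b c → (x :+ x) :* (p :* b) :+ (x :* (p :* a) :+ x :* (p :* c))
                                := (x :* p) :* ((a :+ (b :+ b)) :+ c))
               refl x (x ^ n) (ι a) (ι b) (ι c) ⟩
        x ^ suc n * ((ι a + (ι b + ι b)) + ι c)
      ≈⟨ *-congˡ (sym (trans (ι-+ (a +ℕ (b +ℕ b)) c) (+-congʳ (trans (ι-+ a (b +ℕ b)) (+-congˡ (ι-+ b b)))))) ⟩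
        x ^ suc n * ι ((a +ℕ (b +ℕ b)) +ℕ c)
      ≡⟨ ≡.cong (λ m → x ^ suc n * ι m) (central-pascal-suc n e) ⟨
        x ^ suc n * ι (2 *ℕ suc n C (suc e +ℕ suc n)) ∎
      where
      a = 2 *ℕ n C (e +ℕ n)
      b = 2 *ℕ n C suc (e +ℕ n)
      c = 2 *ℕ n C suc (suc (e +ℕ n))

    narayana-summand : ∀ n k →
      ((signPow R (n ∸ k) * ι (n C k)) * narayanaB R k y) * (1# - x) ^ (2 *ℕ (n ∸ k))
        ≈ ι (n C k) * (s ^ (n ∸ k) * laurent k 0)
    narayana-summand n k = begin
        ((σ * ι (n C k)) * narayanaB R k y) * (1# - x) ^ (2 *ℕ (n ∸ k))
      ≈⟨ solve 4 (λ σ c p u → ((σ :* c) :* p) :* u := c :* ((σ :* u) :* p)) refl σ (ι (n C k)) _ _ ⟩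
        ι (n C k) * ((σ * (1# - x) ^ (2 *ℕ (n ∸ k))) * narayanaB R k y)
      ≈⟨ *-congˡ (*-cong (sym (pow-neg-square (1# - x) (n ∸ k))) (sym (*-identityˡ _))) ⟩
        ι (n C k) * (s ^ (n ∸ k) * laurent k 0) ∎
      where
      σ = signPow R (n ∸ k)

theorem3p2 : ∀ {c ℓ : Level} (R : CommutativeRing c ℓ) (x : CommutativeRing.Carrier R) (n : ℕ) →
    CommutativeRing._≈_ R
      (sumTo R n (λ k → CommutativeRing._*_ R (CommutativeRing._*_ R (CommutativeRing._*_ R (signPow R (n ∸ k)) (fromℕ R (n C k))) (narayanaB R k (CommutativeRing._*_ R x x))) (pow R (CommutativeRing._-_ R (CommutativeRing.1# R) x) (2 *ℕ (n ∸ k)))))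
      (CommutativeRing._*_ R (pow R x n) (fromℕ R ((2 *ℕ n) C n)))
theorem3p2 R x n = begin
    Σ n (λ k → ((signPow R (n ∸ k) * ι (n C k)) * narayanaB R k y) * (1# - x) ^ (2 *ℕ (n ∸ k)))
  ≈⟨ Σ-cong n (narayana-summand n) ⟩
    B n 0
  ≈⟨ B-closed n 0 ⟩
    x ^ n * ι (2 *ℕ n C n) ∎
  where
  open CommutativeRing R
  open import Relation.Binary.Reasoning.Setoid setoid
  open RingIdentities R
  open AtPoint x
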